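{- If a connected graph $G$ admits a modified Tanaka quintuple, then $G$ is of non-QE class.
   Context: For a connected graph $G=(V,E)$ with graph distance $d$, a modified Tanaka quintuple is a sequence of vertices $(v_1,v_2,v_3,v_4,v_5)$ with $\{v_1,v_2\},\{v_3,v_4\}\in E$, $d(v_1,v_3)=d(v_2,v_4)=d(v_1,v_4)-1=d(v_2,v_3)-1$, $d(v_5,v_2)=d(v_5,v_1)+1$ and $d(v_5,v_3)=d(v_5,v_4)$. A finite connected graph is of QE class if there exist a real Hilbert space $\mathcal H$ and $\varphi:V\to\mathcal H$ with $\|\varphi(x)-\varphi(y)\|^2=d(x,y)$ for all $x,y\in V$ (equivalently, $\sum_{x,y}d(x,y)f(x)f(y)\le0$ for all $f:V\to\mathbb R$ with $\sum_xf(x)=0$); otherwise it is of non-QE class. -}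

module Defs where

open import Data.Nat using (ℕ; zero; suc)
open import Data.Bool using (Bool; true; false; _∨_; _∧_; if_then_else_)
open import Data.Fin using (Fin; zero; suc)
open import Data.Fin.Properties using () renaming (_≟_ to _≟ᶠ_)
open import Data.Integer using (+_)
open import Data.Rational using (ℚ; 0ℚ; _+_; _*_; _/_; _≤_)
open import Data.Product using (∃; _×_)
open import Relation.Nullary using (¬_)
open import Relation.Nullary.Decidable using (⌊_⌋)
open import Relation.Binary.PropositionalEquality using (_≡_)

record Graph : Set where
  field
    n      : ℕ
    adj    : Fin n → Fin n → Bool
    sym    : ∀ x y → adj x y ≡ adj y x
    irrefl : ∀ x → adj x x ≡ false

open Graph public

V : Graph → Set
V G = Fin (n G)

Edge : (G : Graph) → V G → V G → Set
Edge G x y = adj G x y ≡ true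

data Walk (G : Graph) : V G → V G → ℕ → Set where
  here : ∀ {x} → Walk G x x zero
  step : ∀ {x y z k} → Edge G x y → Walk G y z k → Walk G x z (suc k)

Connected : Graph → Set
Connected G = ∀ (x y : V G) → ∃ λ k → Walk G x y k

anyFin : ∀ {m} → (Fin m → Bool) → Bool
anyFin {zero}  p = false
anyFin {suc m} p = p zero ∨ anyFin (λ i → p (suc i))

reach : (G : Graph) → ℕ → V G → V G → Bool
reach G zero    x y = ⌊ x ≟ᶠ y ⌋
reach G (suc k) x y = reach G k x y ∨ anyFin (λ z → adj G x z ∧ reach G k z y)

-- least j in [i, i + fuel) with p j = true (returns i + fuel if none).
search : ℕ → ℕ → (ℕ → Bool) → ℕ
search i zero       p = i
search i (suc fuel) p = if p i then i else search (suc i) fuel p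

-- Graph distance: the least k with a walk of length ≤ k from x to y.
-- (For a connected graph on n vertices this is < n, so the search bound
-- n is never hit.)
dist : (G : Graph) → V G → V G → ℕ
dist G x y = search 0 (n G) (λ k → reach G k x y)

ModifiedTanakaQuintuple : (G : Graph) → V G → V G → V G → V G → V G → Set
ModifiedTanakaQuintuple G v₁ v₂ v₃ v₄ v₅ =
  Edge G v₁ v₂ × Edge G v₃ v₄ ×
  d v₁ v₃ ≡ d v₂ v₄ × suc (d v₁ v₃) ≡ d v₁ v₄ × suc (d v₁ v₃) ≡ d v₂ v₃ ×
  d v₅ v₂ ≡ suc (d v₅ v₁) × d v₅ v₃ ≡ d v₅ v₄
  where d = dist G

HasModifiedTanakaQuintuple : Graph → Set
HasModifiedTanakaQuintuple G =
  ∃ λ v₁ → ∃ λ v₂ → ∃ λ v₃ → ∃ λ v₄ → ∃ λ v₅ → ModifiedTanakaQuintuple G v₁ v₂ v₃ v₄ v₅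

sumFin : ∀ {m} → (Fin m → ℚ) → ℚ
sumFin {zero}  f = 0ℚ
sumFin {suc m} f = f zero + sumFin (λ i → f (suc i))

ℕtoℚ : ℕ → ℚ
ℕtoℚ k = + k / 1

distForm : (G : Graph) → (V G → ℚ) → ℚ
distForm G f = sumFin (λ x → sumFin (λ y → ℕtoℚ (dist G x y) * f x * f y))

-- QE class: the distance matrix is conditionally negative definite,
-- i.e. Σ d(x,y) f(x) f(y) ≤ 0 whenever Σ f(x) = 0.
IsQE : Graph → Set
IsQE G = ∀ (f : V G → ℚ) → sumFin f ≡ 0ℚ → distForm G f ≤ 0ℚ

IsNonQE : Graph → Set
IsNonQE G = ¬ IsQE G

-- Put a = d(v₅,v₁), b = d(v₁,v₃), c = d(v₅,v₃). The conditions on a modified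
-- Tanaka quintuple determine every distance between its vertices in terms of
-- a, b and c, and for the zero-sum function
--   f = (a+2)δ₁ − (a+1)δ₂ − (a+1)δ₃ + (a+1)δ₄ − δ₅
-- the quadratic form Σ d(x,y) f(x) f(y) then evaluates to 2 whatever a, b, c
-- are. A positive value on a zero-sum function rules out the QE property.
module Submission where

open import Defs hiding (sym)

open import Level using (0ℓ)
open import Algebra.Bundles.Raw using (RawRing)
import Algebra.Definitions.RawMonoid as RawMonoidDefinitions
open import Data.Fin using (Fin; zero; suc)
open import Data.Vec.Functional using (Vector; _∷_; [])

-- These come before the remaining imports, whose ℚ operators would clash with
-- the ring operations opened here.
module QuadraticForm (R : RawRing 0ℓ 0ℓ) where
  open RawRing R
  open RawMonoidDefinitions +-rawMonoid public using (sum)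

  quadForm : ∀ {m} → (Fin m → Fin m → Carrier) → (Fin m → Carrier) → Carrier
  quadForm M w = sum λ i → sum λ j → M i j * w i * w j

module Tanaka (R : RawRing 0ℓ 0ℓ) where
  open RawRing R

  tanakaWeights : Carrier → Vector Carrier 5
  tanakaWeights a = a + 1# + 1# ∷ - (a + 1#) ∷ - (a + 1#) ∷ a + 1# ∷ - 1# ∷ []

  tanakaMatrix : Carrier → Carrier → Carrier → Vector (Vector Carrier 5) 5
  tanakaMatrix a b c =
    (0#     ∷ 1#     ∷ b      ∷ b + 1# ∷ a      ∷ []) ∷
    (1#     ∷ 0#     ∷ b + 1# ∷ b      ∷ a + 1# ∷ []) ∷
    (b      ∷ b + 1# ∷ 0#     ∷ 1#     ∷ c      ∷ []) ∷
    (b + 1# ∷ b      ∷ 1#     ∷ 0#     ∷ c      ∷ []) ∷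
    (a      ∷ a + 1# ∷ c      ∷ c      ∷ 0#     ∷ []) ∷ []

open import Algebra.Bundles using (Ring)
open import Data.Bool using (Bool; true; false; T; if_then_else_)
open import Data.Bool.Properties using (T-∨; T-∧; T-≡; ⇔→≡)
open import Data.Fin.Patterns using (0F; 1F; 2F; 3F; 4F)
open import Data.Fin.Properties using (_≟_)
open import Data.Integer as ℤ using (+_)
open import Data.Integer.Tactic.RingSolver using (solve-∀)
open import Data.Nat as ℕ using (ℕ; zero; suc; z≤n; s≤s)
open import Data.Nat.Properties using (m≤n⇒m≤1+n)
open import Data.Product as Product using (∃; _×_; _,_)
open import Data.Rational using (ℚ; 0ℚ; 1ℚ; _+_; _*_; _<_; _<?_; toℚᵘ)
open import Data.Rational.Properties
  using ( +-*-rawRing; +-*-ring; +-identityˡ; +-identityʳ; *-identityˡ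
        ; *-identityʳ; *-zeroˡ; *-assoc; <-irrefl; <-≤-trans
        ; toℚᵘ-injective; toℚᵘ-fromℚᵘ; toℚᵘ-homo-+ )
open import Data.Rational.Solver using (module +-*-Solver)
open +-*-Solver using (Polynomial; con; _:+_; _:*_; :-_; solve; _:=_)
open import Data.Rational.Unnormalised as ℚᵘ using (mkℚᵘ; *≡*)
import Data.Rational.Unnormalised.Properties as ℚᵘ
open import Data.Sum using (inj₁; inj₂)
open import Function using (_∘_; id; Equivalence; mk⇔)
open import Relation.Nullary.Decidable using (isYes≗does; dec-false; toWitness; fromWitness)
open import Relation.Binary.PropositionalEquality

open import Algebra.Properties.Semiring.Sum (Ring.semiring +-*-ring)
  using (sum-syntax; sum-cong-≗; sum-replicate-zero; ∑-comm; *-distribˡ-sum; *-distribʳ-sum)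
open Equivalence using (to; from)
open QuadraticForm +-*-rawRing using (sum; quadForm)
open Tanaka +-*-rawRing

ℕtoℚ-suc : ∀ k → ℕtoℚ (suc k) ≡ ℕtoℚ k + 1ℚ
ℕtoℚ-suc k = toℚᵘ-injective (begin
  toℚᵘ (ℕtoℚ (suc k))        ≈⟨ toℚᵘ-fromℚᵘ (mkℚᵘ (+ suc k) 0) ⟩
  mkℚᵘ (+ suc k) 0            ≈⟨ *≡* (cross-multiplied (+ k)) ⟩
  mkℚᵘ (+ k) 0 ℚᵘ.+ ℚᵘ.1ℚᵘ     ≈⟨ ℚᵘ.+-cong (toℚᵘ-fromℚᵘ (mkℚᵘ (+ k) 0)) ℚᵘ.≃-refl ⟨
  toℚᵘ (ℕtoℚ k) ℚᵘ.+ toℚᵘ 1ℚ  ≈⟨ toℚᵘ-homo-+ (ℕtoℚ k) 1ℚ ⟨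
  toℚᵘ (ℕtoℚ k + 1ℚ)         ∎)
  where
  open ℚᵘ.≃-Reasoning
  cross-multiplied : ∀ i → (+ 1 ℤ.+ i) ℤ.* + 1 ≡ (i ℤ.* + 1 ℤ.+ + 1 ℤ.* + 1) ℤ.* + 1
  cross-multiplied = solve-∀

sumFin≡sum : ∀ {m} (f : Fin m → ℚ) → sumFin f ≡ sum f
sumFin≡sum {zero}  f = refl
sumFin≡sum {suc m} f = cong (_+_ (f zero)) (sumFin≡sum (f ∘ suc))

δ : ∀ {m} → Fin m → Fin m → ℚ
δ zero    zero    = 1ℚ
δ zero    (suc _) = 0ℚ
δ (suc _) zero    = 0ℚ
δ (suc u) (suc x) = δ u x

∑-δ-* : ∀ {m} (u : Fin m) (h : Fin m → ℚ) → ∑[ x < m ] (δ u x * h x) ≡ h u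
∑-δ-* {suc m} zero h = begin
  1ℚ * h zero + ∑[ x < m ] (0ℚ * h (suc x)) ≡⟨ cong₂ _+_ (*-identityˡ (h zero)) ∑0≡0 ⟩
  h zero + 0ℚ                               ≡⟨ +-identityʳ (h zero) ⟩
  h zero                                    ∎
  where
  open ≡-Reasoning
  ∑0≡0 : ∑[ x < m ] (0ℚ * h (suc x)) ≡ 0ℚ
  ∑0≡0 = trans (sum-cong-≗ λ x → *-zeroˡ (h (suc x))) (sum-replicate-zero m)
∑-δ-* {suc m} (suc u) h = begin
  0ℚ * h zero + ∑[ x < m ] (δ u x * h (suc x)) ≡⟨ cong₂ _+_ (*-zeroˡ (h zero)) (∑-δ-* u (h ∘ suc)) ⟩
  0ℚ + h (suc u)                               ≡⟨ +-identityˡ (h (suc u)) ⟩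
  h (suc u)                                    ∎
  where open ≡-Reasoning

quadForm-cong : ∀ {m} {M N : Fin m → Fin m → ℚ} → (∀ i j → M i j ≡ N i j) →
                (w : Fin m → ℚ) → quadForm M w ≡ quadForm N w
quadForm-cong M≡N w = sum-cong-≗ λ i → sum-cong-≗ λ j → cong (λ e → e * w i * w j) (M≡N i j)

quadForm-pairing : ∀ {m} (D : Fin m → Fin m → ℚ) (f : Fin m → ℚ) →
                   quadForm D f ≡ ∑[ x < m ] (f x * ∑[ y < m ] (f y * D x y))
quadForm-pairing D f = sum-cong-≗ λ x →
  trans (sum-cong-≗ λ y → rearrange (D x y) (f x) (f y)) (sym (*-distribˡ-sum (f x) λ y → f y * D x y))
  where
  rearrange : ∀ d p q → d * p * q ≡ p * (q * d)
  rearrange = solve 3 (λ d p q → d :* p :* q := p :* (q :* d)) refl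

distForm≡quadForm : ∀ G (f : V G → ℚ) → distForm G f ≡ quadForm (λ x y → ℕtoℚ (dist G x y)) f
distForm≡quadForm G f =
  trans (sumFin≡sum λ x → sumFin (Q x)) (sum-cong-≗ λ x → sumFin≡sum (Q x))
  where
  Q : V G → V G → ℚ
  Q x y = ℕtoℚ (dist G x y) * f x * f y

combination : ∀ {k m} → Vector (Fin m) k → Vector ℚ k → Fin m → ℚ
combination {k} σ w x = ∑[ i < k ] (w i * δ (σ i) x)

module _ {k m} (σ : Vector (Fin m) k) (w : Vector ℚ k) where

  ∑-combination-* : (h : Fin m → ℚ) → ∑[ x < m ] (combination σ w x * h x) ≡ ∑[ i < k ] (w i * h (σ i))
  ∑-combination-* h = begin
    ∑[ x < m ] (combination σ w x * h x)
      ≡⟨ sum-cong-≗ (λ x → *-distribʳ-sum (h x) λ i → w i * δ (σ i) x) ⟩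
    ∑[ x < m ] ∑[ i < k ] (w i * δ (σ i) x * h x)
      ≡⟨ ∑-comm (λ x i → w i * δ (σ i) x * h x) ⟩
    ∑[ i < k ] ∑[ x < m ] (w i * δ (σ i) x * h x)
      ≡⟨ sum-cong-≗ factor ⟩
    ∑[ i < k ] (w i * ∑[ x < m ] (δ (σ i) x * h x))
      ≡⟨ sum-cong-≗ (λ i → cong (w i *_) (∑-δ-* (σ i) h)) ⟩
    ∑[ i < k ] (w i * h (σ i)) ∎
    where
    open ≡-Reasoning
    factor : ∀ i → ∑[ x < m ] (w i * δ (σ i) x * h x) ≡ w i * ∑[ x < m ] (δ (σ i) x * h x)
    factor i = trans (sum-cong-≗ λ x → *-assoc (w i) (δ (σ i) x) (h x))
                     (sym (*-distribˡ-sum (w i) λ x → δ (σ i) x * h x))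

  sum-combination : sum (combination σ w) ≡ sum w
  sum-combination = begin
    sum (combination σ w)                 ≡⟨ sum-cong-≗ (λ x → *-identityʳ (combination σ w x)) ⟨
    ∑[ x < m ] (combination σ w x * 1ℚ)   ≡⟨ ∑-combination-* (λ _ → 1ℚ) ⟩
    ∑[ i < k ] (w i * 1ℚ)                 ≡⟨ sum-cong-≗ (λ i → *-identityʳ (w i)) ⟩
    sum w                                 ∎
    where open ≡-Reasoning

  quadForm-combination : (D : Fin m → Fin m → ℚ) →
                         quadForm D (combination σ w) ≡ quadForm (λ i j → D (σ i) (σ j)) w
  quadForm-combination D = begin
    quadForm D f                                          ≡⟨ quadForm-pairing D f ⟩
    ∑[ x < m ] (f x * ∑[ y < m ] (f y * D x y))           ≡⟨ sum-cong-≗ (λ x → cong (f x *_) (∑-combination-* (D x))) ⟩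
    ∑[ x < m ] (f x * ∑[ j < k ] (w j * D x (σ j)))       ≡⟨ ∑-combination-* (λ x → ∑[ j < k ] (w j * D x (σ j))) ⟩
    ∑[ i < k ] (w i * ∑[ j < k ] (w j * D (σ i) (σ j)))   ≡⟨ quadForm-pairing (λ i j → D (σ i) (σ j)) w ⟨
    quadForm (λ i j → D (σ i) (σ j)) w                    ∎
    where
    open ≡-Reasoning
    f = combination σ w

positiveDistForm⇒nonQE : ∀ G (f : V G → ℚ) → sumFin f ≡ 0ℚ → 0ℚ < distForm G f → IsNonQE G
positiveDistForm⇒nonQE G f Σf≡0 0<Qf qe = <-irrefl refl (<-≤-trans 0<Qf (qe f Σf≡0))

-- Evaluating the same definitions in the ring of polynomials over ℚ lets the
-- ring solver check identities between them.
polynomials : ℕ → RawRing 0ℓ 0ℓ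
polynomials n = record
  { Carrier = Polynomial n ; _≈_ = _≡_ ; _+_ = _:+_ ; _*_ = _:*_ ; -_ = :-_
  ; 0# = con 0ℚ ; 1# = con 1ℚ }

module Symbolic (n : ℕ) where
  open QuadraticForm (polynomials n) public
  open Tanaka (polynomials n) public

sum-tanakaWeights : ∀ a → sum (tanakaWeights a) ≡ 0ℚ
sum-tanakaWeights = solve 1 (λ a → Symbolic.sum 1 (Symbolic.tanakaWeights 1 a) := con 0ℚ) refl

quadForm-tanaka : ∀ a b c → quadForm (tanakaMatrix a b c) (tanakaWeights a) ≡ 1ℚ + 1ℚ
quadForm-tanaka = solve 3 (λ a b c →
  Symbolic.quadForm 3 (Symbolic.tanakaMatrix 3 a b c) (Symbolic.tanakaWeights 3 a) := con 1ℚ :+ con 1ℚ) refl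

anyFin-intro : ∀ {m} (p : Fin m → Bool) z → T (p z) → T (anyFin p)
anyFin-intro p zero    t = from T-∨ (inj₁ t)
anyFin-intro p (suc z) t = from (T-∨ {p zero}) (inj₂ (anyFin-intro (p ∘ suc) z t))

anyFin-elim : ∀ {m} (p : Fin m → Bool) → T (anyFin p) → ∃ (T ∘ p)
anyFin-elim {suc m} p t with to (T-∨ {p zero}) t
... | inj₁ t₀ = zero , t₀
... | inj₂ t₁ = Product.map suc id (anyFin-elim (p ∘ suc) t₁)

search-cong : ∀ i fuel {p q : ℕ → Bool} → p ≗ q → search i fuel p ≡ search i fuel q
search-cong i zero       p≗q = refl
search-cong i (suc fuel) p≗q =
  cong₂ (λ b s → if b then i else s) (p≗q i) (search-cong (suc i) fuel p≗q)

search-here : ∀ i fuel {p : ℕ → Bool} → p i ≡ true → search i fuel p ≡ i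
search-here i zero       hit = refl
search-here i (suc fuel) {p} hit = cong (λ b → if b then i else search (suc i) fuel p) hit

search-next : ∀ i fuel {p : ℕ → Bool} → p i ≡ false → search i (suc fuel) p ≡ search (suc i) fuel p
search-next i fuel {p} miss = cong (λ b → if b then i else search (suc i) fuel p) miss

module _ (G : Graph) where

  reverse-edge : ∀ {x y} → Edge G x y → Edge G y x
  reverse-edge {x} {y} e = trans (Graph.sym G y x) e

  snoc : ∀ {x y z j} → Walk G x y j → Edge G y z → Walk G x z (suc j)
  snoc here         e = step e here
  snoc (step e′ w) e = step e′ (snoc w e)

  reverse : ∀ {x y j} → Walk G x y j → Walk G y x j
  reverse here       = here
  reverse (step e w) = snoc (reverse w) (reverse-edge e)

  reach-sound : ∀ k {x y} → T (reach G k x y) → ∃ λ j → j ℕ.≤ k × Walk G x y j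
  reach-sound zero {x} {y} r with refl ← toWitness {a? = x ≟ y} r = 0 , z≤n , here
  reach-sound (suc k) {x} {y} r with to (T-∨ {reach G k x y}) r
  ... | inj₁ r′ = Product.map₂ (Product.map₁ m≤n⇒m≤1+n) (reach-sound k r′)
  ... | inj₂ r′ with z , t ← anyFin-elim _ r′ with e , rz ← to (T-∧ {adj G x z}) t =
    Product.map suc (Product.map s≤s (step (to T-≡ e))) (reach-sound k rz)

  reach-complete : ∀ k {x y j} → Walk G x y j → j ℕ.≤ k → T (reach G k x y)
  reach-complete zero    here z≤n = fromWitness refl
  reach-complete (suc k) here _   = from T-∨ (inj₁ (reach-complete k here z≤n))
  reach-complete (suc k) {x} (step {y = z} e w) (s≤s j≤k) =
    from (T-∨ {reach G k x _}) (inj₂ (anyFin-intro _ z (from T-∧ (from T-≡ e , reach-complete k w j≤k))))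

  reach-reverse : ∀ k {x y} → reach G k x y ≡ true → reach G k y x ≡ true
  reach-reverse k r with j , j≤k , w ← reach-sound k (from T-≡ r) = to T-≡ (reach-complete k (reverse w) j≤k)

  dist-sym : ∀ x y → dist G x y ≡ dist G y x
  dist-sym x y = search-cong 0 (n G) λ k → ⇔→≡ (mk⇔ (reach-reverse k) (reach-reverse k))

  dist-refl : ∀ x → dist G x x ≡ 0
  dist-refl x = search-here 0 (n G) (to T-≡ (reach-complete 0 here z≤n))

  dist-edge : ∀ {x y} → Edge G x y → dist G x y ≡ 1
  dist-edge {x} {y} e = second-hit x
    where
    x≢y : x ≢ y
    x≢y refl with () ← trans (sym e) (irrefl G x)
    -- The vertex x rules out a search with no fuel at all.
    second-hit : ∀ {m} → Fin m → search 0 m (λ k → reach G k x y) ≡ 1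
    second-hit {suc m} _ = trans (search-next 0 m (trans (isYes≗does (x ≟ y)) (dec-false (x ≟ y) x≢y)))
      (search-here 1 m (to T-≡ (reach-complete 1 (step e here) (s≤s z≤n))))

module Quintuple {G : Graph} (v₁ v₂ v₃ v₄ v₅ : V G) where

  vertices : Vector (V G) 5
  vertices = v₁ ∷ v₂ ∷ v₃ ∷ v₄ ∷ v₅ ∷ []

  distℚ : V G → V G → ℚ
  distℚ x y = ℕtoℚ (dist G x y)

  weights : Vector ℚ 5
  weights = tanakaWeights (distℚ v₅ v₁)

  testFunction : V G → ℚ
  testFunction = combination vertices weights

  sumFin-testFunction : sumFin testFunction ≡ 0ℚ
  sumFin-testFunction = begin
    sumFin testFunction ≡⟨ sumFin≡sum testFunction ⟩
    sum testFunction    ≡⟨ sum-combination vertices weights ⟩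
    sum weights         ≡⟨ sum-tanakaWeights (distℚ v₅ v₁) ⟩
    0ℚ                  ∎
    where open ≡-Reasoning

  quintuple-distances : ModifiedTanakaQuintuple G v₁ v₂ v₃ v₄ v₅ → ∀ i j →
    distℚ (vertices i) (vertices j) ≡ tanakaMatrix (distℚ v₅ v₁) (distℚ v₁ v₃) (distℚ v₅ v₃) i j
  quintuple-distances (e₁₂ , e₃₄ , d₁₃≡d₂₄ , d₁₃+1≡d₁₄ , d₁₃+1≡d₂₃ , d₅₂≡d₅₁+1 , d₅₃≡d₅₄) = table
    where
    diagonal : ∀ x → distℚ x x ≡ 0ℚ
    diagonal x = cong ℕtoℚ (dist-refl G x)

    edge : ∀ {x y} → Edge G x y → distℚ x y ≡ 1ℚ
    edge e = cong ℕtoℚ (dist-edge G e)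

    one-more : ∀ {x y k} → dist G x y ≡ suc k → distℚ x y ≡ ℕtoℚ k + 1ℚ
    one-more {k = k} e = trans (cong ℕtoℚ e) (ℕtoℚ-suc k)

    mirror : ∀ {x y r} → distℚ x y ≡ r → distℚ y x ≡ r
    mirror {x} {y} = trans (cong ℕtoℚ (dist-sym G y x))

    table : ∀ i j → distℚ (vertices i) (vertices j) ≡ tanakaMatrix (distℚ v₅ v₁) (distℚ v₁ v₃) (distℚ v₅ v₃) i j
    table 0F 0F = diagonal v₁
    table 0F 1F = edge e₁₂
    table 0F 2F = refl
    table 0F 3F = one-more (sym d₁₃+1≡d₁₄)
    table 0F 4F = mirror refl
    table 1F 0F = mirror (table 0F 1F)
    table 1F 1F = diagonal v₂
    table 1F 2F = one-more (sym d₁₃+1≡d₂₃)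
    table 1F 3F = cong ℕtoℚ (sym d₁₃≡d₂₄)
    table 1F 4F = mirror (one-more d₅₂≡d₅₁+1)
    table 2F 0F = mirror (table 0F 2F)
    table 2F 1F = mirror (table 1F 2F)
    table 2F 2F = diagonal v₃
    table 2F 3F = edge e₃₄
    table 2F 4F = mirror refl
    table 3F 0F = mirror (table 0F 3F)
    table 3F 1F = mirror (table 1F 3F)
    table 3F 2F = mirror (table 2F 3F)
    table 3F 3F = diagonal v₄
    table 3F 4F = mirror (cong ℕtoℚ (sym d₅₃≡d₅₄))
    table 4F 0F = mirror (table 0F 4F)
    table 4F 1F = mirror (table 1F 4F)
    table 4F 2F = mirror (table 2F 4F)
    table 4F 3F = mirror (table 3F 4F)
    table 4F 4F = diagonal v₅

  distForm-testFunction : ModifiedTanakaQuintuple G v₁ v₂ v₃ v₄ v₅ → distForm G testFunction ≡ 1ℚ + 1ℚ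
  distForm-testFunction q = begin
    distForm G testFunction                                     ≡⟨ distForm≡quadForm G testFunction ⟩
    quadForm distℚ testFunction                                 ≡⟨ quadForm-combination vertices weights distℚ ⟩
    quadForm (λ i j → distℚ (vertices i) (vertices j)) weights  ≡⟨ quadForm-cong (quintuple-distances q) weights ⟩
    quadForm (tanakaMatrix a b c) weights                       ≡⟨ quadForm-tanaka a b c ⟩
    1ℚ + 1ℚ                                                     ∎
    where
    open ≡-Reasoning
    a = distℚ v₅ v₁
    b = distℚ v₁ v₃
    c = distℚ v₅ v₃

theorem6p1 : (G : Graph) → Connected G → HasModifiedTanakaQuintuple G → IsNonQE G
theorem6p1 G _ (v₁ , v₂ , v₃ , v₄ , v₅ , q) =
  positiveDistForm⇒nonQE G testFunction sumFin-testFunction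
    (subst (0ℚ <_) (sym (distForm-testFunction q)) 0<2)
  where
  open Quintuple v₁ v₂ v₃ v₄ v₅
  0<2 : 0ℚ < 1ℚ + 1ℚ
  0<2 = toWitness {a? = 0ℚ <? 1ℚ + 1ℚ} _
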